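{- For every LNF-term $M$ and variable $y$, $\mathsf{C}_v(M:y.\uparrow y)\twoheadrightarrow M$ in LNF.
   Context: Terms up to $\alpha$-equivalence; one-step reduction is the closure of the rules under all constructors. LNF: terms $M,N::=\uparrow V\mid x(V,y.N)\mid\mathsf{C}_v(V,x.N)$; values $V,W::=x\mid\lambda x.M$ (in $y(V,z.N)$ and $x.N$ the variable before the dot is bound in the following term). Value substitution $[V/y]$: homomorphic and capture-avoiding ($[V/y]y=V$, $[V/y]z=z$ for $z\neq y$), except: $[V/y](y(W,x.P))=\mathsf{C}_v(V,y'.y'([V/y]W,x.[V/y]P))$ with $y'$ fresh if $V$ is an abstraction, and $[x'/y](y(W,x.P))=x'([x'/y]W,x.[x'/y]P)$. Derived cut: $\mathsf{C}_v(\uparrow V:z.N)=\mathsf{C}_v(V,z.N)$; $\mathsf{C}_v(x(V,y.M):z.N)=x(V,y.\mathsf{C}_v(M:z.N))$; $\mathsf{C}_v(\mathsf{C}_v(V,y.M):z.N)=\mathsf{C}_v(V,y.\mathsf{C}_v(M:z.N))$. Rules: $(B_v)$ $\mathsf{C}_v(\lambda x.M,y.y(V,z.N))\to\mathsf{C}_v(V,x.\mathsf{C}_v(M:z.N))$ if $y\notin FV(V)\cup FV(N)$; $(\sigma_v)$ $\mathsf{C}_v(V,y.N)\to[V/y]N$ if $B_v$ does not apply. -}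

module Defs where

open import Data.Nat using (ℕ; zero; suc)
open import Data.Fin using (Fin; zero; suc)
open import Data.Product using (Σ; _×_; _,_)
open import Relation.Binary.PropositionalEquality using (_≡_)
open import Relation.Nullary using (¬_)
open import Relation.Binary.Construct.Closure.ReflexiveTransitive using (Star)

-- LNF terms, intrinsically scoped with de Bruijn indices (terms up to α-equivalence).
-- Val n / Tm n : values / terms whose free variables are among Fin n.
mutual
  data Val (n : ℕ) : Set where
    var : Fin n → Val n
    lam : Tm (suc n) → Val n
  data Tm (n : ℕ) : Set where
    ret : Val n → Tm n                  -- ↑V
    app : Fin n → Val n → Tm (suc n) → Tm n   -- x(V, y.N)   (y bound in N, index 0)
    cut : Val n → Tm (suc n) → Tm n           -- C_v(V, x.N) (x bound in N, index 0)

Ren : ℕ → ℕ → Set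
Ren n m = Fin n → Fin m

liftR : ∀ {n m} → Ren n m → Ren (suc n) (suc m)
liftR ρ zero    = zero
liftR ρ (suc i) = suc (ρ i)

mutual
  renV : ∀ {n m} → Ren n m → Val n → Val m
  renV ρ (var x) = var (ρ x)
  renV ρ (lam M) = lam (renT (liftR ρ) M)

  renT : ∀ {n m} → Ren n m → Tm n → Tm m
  renT ρ (ret V)     = ret (renV ρ V)
  renT ρ (app x V N) = app (ρ x) (renV ρ V) (renT (liftR ρ) N)
  renT ρ (cut V N)   = cut (renV ρ V) (renT (liftR ρ) N)

wkV : ∀ {n} → Val n → Val (suc n)
wkV = renV suc

wkT₁ : ∀ {n} → Tm (suc n) → Tm (suc (suc n))
wkT₁ = renT (liftR suc)

-- Homomorphic and capture-avoiding, except at a head variable: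
--   if σ y = λ-abstraction V:  y(W,x.P) ↦ C_v(V, y'. y'(σW, x.σP))  (y' fresh)
--   if σ y = variable x':      y(W,x.P) ↦ x'(σW, x.σP)
Sub : ℕ → ℕ → Set
Sub n m = Fin n → Val m

exts : ∀ {n m} → Sub n m → Sub (suc n) (suc m)
exts σ zero    = var zero
exts σ (suc i) = wkV (σ i)

mutual
  subV : ∀ {n m} → Sub n m → Val n → Val m
  subV σ (var x) = σ x
  subV σ (lam M) = lam (subT (exts σ) M)

  subT : ∀ {n m} → Sub n m → Tm n → Tm m
  subT σ (ret V)     = ret (subV σ V)
  subT σ (app y W P) = headApp (σ y) (subV σ W) (subT (exts σ) P)
  subT σ (cut V N)   = cut (subV σ V) (subT (exts σ) N)

  headApp : ∀ {m} → Val m → Val m → Tm (suc m) → Tm m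
  headApp (var x') W P = app x' W P
  headApp (lam M)  W P = cut (lam M) (app zero (wkV W) (wkT₁ P))

single : ∀ {n} → Val n → Sub (suc n) n
single V zero    = V
single V (suc i) = var i

_[_] : ∀ {n} → Tm (suc n) → Val n → Tm n
N [ V ] = subT (single V) N

-- Derived cut  C_v(M : z.N)
dcut : ∀ {n} → Tm n → Tm (suc n) → Tm n
dcut (ret V)     N = cut V N
dcut (app x V M) N = app x V (dcut M (wkT₁ N))
dcut (cut V M)   N = cut V (dcut M (wkT₁ N))

-- "B_v applies to C_v(V, y.N)": V = λx.M and N = y(V', z.N') with y ∉ FV(V') ∪ FV(N')
-- (freshness of y = index 0 expressed as: V' and N' are weakenings).
BvApplies : ∀ {n} → Val n → Tm (suc n) → Set
BvApplies {n} V N =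
  Σ (Tm (suc n)) λ M → Σ (Val n) λ V₀ → Σ (Tm (suc n)) λ N₀ →
    (V ≡ lam M) × (N ≡ app zero (wkV V₀) (wkT₁ N₀))

mutual
  data _⟶_ {n : ℕ} : Tm n → Tm n → Set where
    Bv   : (M : Tm (suc n)) (V : Val n) (N : Tm (suc n)) →
           cut (lam M) (app zero (wkV V) (wkT₁ N)) ⟶ cut V (dcut M (wkT₁ N))
    σv   : (V : Val n) (N : Tm (suc n)) → ¬ BvApplies V N →
           cut V N ⟶ (N [ V ])
    ξret  : ∀ {V V'} → V ⟶V V' → ret V ⟶ ret V'
    ξappV : ∀ {x V V' N} → V ⟶V V' → app x V N ⟶ app x V' N
    ξappN : ∀ {x V N N'} → N ⟶ N' → app x V N ⟶ app x V N'
    ξcutV : ∀ {V V' N} → V ⟶V V' → cut V N ⟶ cut V' N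
    ξcutN : ∀ {V N N'} → N ⟶ N' → cut V N ⟶ cut V N'

  data _⟶V_ {n : ℕ} : Val n → Val n → Set where
    ξlam : ∀ {M M'} → M ⟶ M' → lam M ⟶V lam M'

_↠_ : ∀ {n} → Tm n → Tm n → Set
_↠_ = Star _⟶_

-- A derived cut against the identity continuation y.↑y pushes that continuation
-- down the spine of M (weakening leaves y.↑y unchanged, definitionally) until it
-- meets the final ↑V, where it becomes C_v(V, y.↑y);
-- B_v cannot fire there (the body is not an application), so σ_v contracts it to ↑V,
-- and the spine above is rebuilt unchanged by congruence.
module Submission where

open import Defs
open import Data.Nat using (ℕ; suc)
open import Data.Fin using (Fin; zero)
open import Data.Product using (_,_)
open import Relation.Nullary using (¬_)
open import Relation.Binary.Construct.Closure.ReflexiveTransitive using (gmap; return)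

app-cong-↠ : ∀ {n} {x : Fin n} {V : Val n} {N N′ : Tm (suc n)} →
             N ↠ N′ → app x V N ↠ app x V N′
app-cong-↠ = gmap _ ξappN

cut-cong-↠ : ∀ {n} {V : Val n} {N N′ : Tm (suc n)} →
             N ↠ N′ → cut V N ↠ cut V N′
cut-cong-↠ = gmap _ ξcutN

¬BvApplies-ret : ∀ {n} (V : Val n) (W : Val (suc n)) → ¬ BvApplies V (ret W)
¬BvApplies-ret V W (_ , _ , _ , _ , ())

lemma7 : ∀ {n : ℕ} (M : Tm n) → dcut M (ret (var zero)) ↠ M
lemma7 (ret V)     = return (σv V (ret (var zero)) (¬BvApplies-ret V (var zero)))
lemma7 (app x V M) = app-cong-↠ (lemma7 M)
lemma7 (cut V M)   = cut-cong-↠ (lemma7 M)
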